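{- Let $d$ be a nonnegative integer and let $H$ be a multigraph of even order with $\phi(H)\le d+1$. Let $S\subseteq V(H)$ with $|S|$ odd, $|S|\ge 3$, and $t(\langle S\rangle) = d+1$. Let $r$ be the number of vertices of degree $d+1$ in $H$, and let $S^c = V(H)\setminus S$. Then $\Delta(H_S)\le d+1$, $\Gamma(H_S)\le d+1$, and $H_S$ has at most $r$ vertices of degree $d+1$. Also $\Delta(H_{S^c})\le d+1$, $\Gamma(H_{S^c})\le d+1$, and if $H_{S^c}$ has more than $r$ vertices of degree $d+1$, then $H_{S^c}$ has exactly $r+1$ vertices, each of degree $d+1$ (each $\Gamma$-inequality whenever the multigraph in question has at least 3 vertices).
   Context: Multigraphs are finite and loopless, with parallel edges allowed. $\langle S\rangle$ is the induced subgraph on $S$. For a multigraph $H$ of odd order $\ge 3$, $t(H)=2e(H)/(n(H)-1)$. For a multigraph with at least 3 vertices, $\Gamma(H) = \max\{t(\langle S\rangle): |S|\text{ odd},\ |S|\ge 3\}$ (undefined for fewer than 3 vertices). $\chi_f(H)=\max\{\Delta(H),\Gamma(H)\}$ (equal to $\Delta(H)$ if $H$ has fewer than 3 vertices) and $\phi(H) = \lceil\chi_f(H)\rceil$. Shrinking: for a nonempty proper subset $S$ of $V(H)$, $H_S$ has vertex set $(V(H)\setminus S)\cup\{s\}$ with $s$ new; its edges are those of $H$ with both ends outside $S$, plus, for each $u\notin S$, as many $u$–$s$ edges as there are edges of $H$ joining $u$ to $S$. -}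

module Defs where

open import Data.Nat using (ℕ; zero; suc; _+_; _*_; _∸_; _≤_; _<_; _%_)
open import Data.Nat.Properties using (_≟_)
open import Data.Bool using (Bool; true; false; if_then_else_; not; _∧_)
open import Data.Fin using (Fin; zero; suc)
open import Data.Fin.Subset using (Subset; ∣_∣; ⊤)
open import Data.Vec using (lookup)
open import Data.List using (List; length; allFin; filterᵇ)
import Data.List as L
open import Data.Integer using (+_)
open import Data.Rational.Unnormalised using (ℚᵘ; mkℚᵘ)
open import Data.Product using (_×_)
open import Relation.Binary.PropositionalEquality using (_≡_)
open import Relation.Nullary.Decidable using (⌊_⌋)

Odd : ℕ → Set
Odd n = n % 2 ≡ 1

Even : ℕ → Set
Even n = n % 2 ≡ 0

sumFin : (n : ℕ) → (Fin n → ℕ) → ℕ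
sumFin zero    f = 0
sumFin (suc n) f = f zero + sumFin n (λ i → f (suc i))

-- A multigraph on vertex set Fin n is given by its edge-multiplicity function:
-- mult u v = number of edges joining u and v.
Mult : ℕ → Set
Mult n = Fin n → Fin n → ℕ

IsMultigraph : {n : ℕ} → Mult n → Set
IsMultigraph {n} m = ((u v : Fin n) → m u v ≡ m v u) × ((v : Fin n) → m v v ≡ 0)

deg : {n : ℕ} → Mult n → Fin n → ℕ
deg {n} m v = sumFin n (λ u → m v u)

MaxDegLe : {n : ℕ} → Mult n → ℕ → Set
MaxDegLe {n} m k = (v : Fin n) → deg m v ≤ k

numDeg : {n : ℕ} → Mult n → ℕ → ℕ
numDeg {n} m k = sumFin n (λ v → if ⌊ deg m v ≟ k ⌋ then 1 else 0)

twoEdgesIn : {n : ℕ} → Mult n → Subset n → ℕ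
twoEdgesIn {n} m S =
  sumFin n (λ u → sumFin n (λ v →
    if lookup S u ∧ lookup S v then m u v else 0))

-- t(⟨S⟩) = 2 e(⟨S⟩) / (|S| - 1), as an unnormalised rational
-- (mkℚᵘ p q denotes p / (q+1); meaningful for |S| ≥ 2, used only for |S| odd ≥ 3)
tSub : {n : ℕ} → Mult n → Subset n → ℚᵘ
tSub m S = mkℚᵘ (+ twoEdgesIn m S) (∣ S ∣ ∸ 2)

t : {n : ℕ} → Mult n → ℚᵘ
t m = tSub m ⊤

ℕtoℚ : ℕ → ℚᵘ
ℕtoℚ k = mkℚᵘ (+ k) 0

GammaLe : {n : ℕ} → Mult n → ℕ → Set
GammaLe {n} m k = (S : Subset n) → Odd ∣ S ∣ → 3 ≤ ∣ S ∣ →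
  Data.Rational.Unnormalised._≤_ (tSub m S) (ℕtoℚ k)

-- φ(H) ≤ k for an integer k: ⌈max(Δ,Γ)⌉ ≤ k  iff  Δ ≤ k and Γ ≤ k
-- (Γ only when H has at least 3 vertices)
PhiLe : {n : ℕ} → Mult n → ℕ → Set
PhiLe {n} m k = MaxDegLe m k × (3 ≤ n → GammaLe m k)

outside : {n : ℕ} → Subset n → List (Fin n)
outside {n} S = filterᵇ (λ v → not (lookup S v)) (allFin n)

shrinkN : {n : ℕ} → Subset n → ℕ
shrinkN S = suc (length (outside S))

toSet : {n : ℕ} → Mult n → Subset n → Fin n → ℕ
toSet {n} m S u = sumFin n (λ w → if lookup S w then m u w else 0)

-- H_S on vertex set Fin (shrinkN S): vertex zero is the new vertex s,
-- vertex (suc i) is the i-th vertex outside S.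
shrink : {n : ℕ} → (m : Mult n) → (S : Subset n) → Mult (shrinkN S)
shrink m S zero    zero    = 0
shrink m S zero    (suc j) = toSet m S (L.lookup (outside S) j)
shrink m S (suc i) zero    = toSet m S (L.lookup (outside S) i)
shrink m S (suc i) (suc j) = m (L.lookup (outside S) i) (L.lookup (outside S) j)

-- Write D = d + 1 and e(A, B) for the number of edges between A and B. As 2e(⟨S⟩) = D(|S| − 1)
-- and all degrees are at most D, summing degrees over S gives e(S, Sᶜ) ≤ D, with equality only
-- if every vertex of S has degree D; this bounds the degree of the new vertex and the number of
-- vertices of degree D. An odd set of a shrunk graph either is an odd set of H or consists of
-- the new vertex and an even set A. For A ⊆ Sᶜ, Γ(H) ≤ D on the odd set S ∪ A minus the tight
-- contribution of S gives the bound. For A ⊆ S, Γ(H) ≤ D on the odd set S ∖ A together with the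
-- degree bound on A forces e(A, S ∖ A) ≥ e(A, Sᶜ), which again gives the bound.

module Submission where

open import Defs
open import Data.Nat using (ℕ; zero; suc; _+_; _*_; _∸_; _%_; _≤_; _<_; z≤n; s≤s)
open import Data.Nat.Properties
open import Data.Nat.DivMod using (%-distribˡ-+; m%n<n)
open import Data.Nat.ListAction using (sum)
open import Algebra.Properties.CommutativeSemigroup +-commutativeSemigroup using (interchange; x∙yz≈zx∙y)
open import Data.Bool using (Bool; true; false; if_then_else_; not; _∧_; _∨_; T)
open import Data.Bool.Properties using (not-involutive; ∨-identityʳ; ∧-zeroʳ)
open import Data.Fin using (Fin; zero; suc)
import Data.Fin.Properties as Finₚ
open import Data.Fin.Subset using (Subset; ∣_∣; ∁)
open import Data.Fin.Subset.Properties using (∣p∣≤n)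
open import Data.Vec using (Vec; []; _∷_; lookup; tabulate)
open import Data.Vec.Properties using (lookup-map; lookup∘tabulate)
open import Data.List using (List; []; _∷_; length; allFin; filterᵇ)
import Data.List as List
import Data.List.Relation.Unary.All as All
open import Data.List.Relation.Unary.All.Properties using (all-filter)
open import Data.List.Relation.Unary.AllPairs using (_∷_)
open import Data.List.Relation.Unary.Unique.Propositional using (Unique)
open import Data.List.Relation.Unary.Unique.Propositional.Properties using (allFin⁺; filter⁺)
open import Data.List.Membership.Propositional.Properties using (∈-lookup)
import Data.Integer as ℤ
import Data.Integer.Properties as ℤ
open import Data.Rational.Unnormalised using (mkℚᵘ; _≃_; *≡*; *≤*)
import Data.Rational.Unnormalised as ℚᵘ
open import Data.Product using (_×_; _,_; proj₁; proj₂)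
open import Data.Sum using (_⊎_; inj₁; inj₂)
open import Data.Empty using (⊥-elim)
open import Function using (_∘_; _$_; const)
open import Relation.Binary.PropositionalEquality
  using (_≡_; refl; sym; trans; cong; cong₂; subst; subst₂; _≗_; module ≡-Reasoning)
open import Relation.Nullary using (Dec; yes; no)
open import Relation.Nullary.Decidable using (⌊_⌋; T?; dec-true; isYes≗does)

sum-cong : ∀ n {f g : Fin n → ℕ} → f ≗ g → sumFin n f ≡ sumFin n g
sum-cong zero    f≗g = refl
sum-cong (suc n) f≗g = cong₂ _+_ (f≗g zero) (sum-cong n (f≗g ∘ suc))

sum-zero : ∀ n {f : Fin n → ℕ} → (∀ i → f i ≡ 0) → sumFin n f ≡ 0
sum-zero zero    f≡0 = refl
sum-zero (suc n) f≡0 rewrite f≡0 zero = sum-zero n (f≡0 ∘ suc)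

sum-+ : ∀ n (f g : Fin n → ℕ) → sumFin n (λ i → f i + g i) ≡ sumFin n f + sumFin n g
sum-+ zero    f g = refl
sum-+ (suc n) f g rewrite sum-+ n (f ∘ suc) (g ∘ suc) = interchange (f zero) (g zero) _ _

sum-*ˡ : ∀ n c (f : Fin n → ℕ) → sumFin n (λ i → c * f i) ≡ c * sumFin n f
sum-*ˡ zero    c f = sym (*-zeroʳ c)
sum-*ˡ (suc n) c f rewrite sum-*ˡ n c (f ∘ suc) = sym (*-distribˡ-+ c (f zero) _)

sum-comm : ∀ n k (f : Fin n → Fin k → ℕ) →
  sumFin n (λ i → sumFin k (f i)) ≡ sumFin k (λ j → sumFin n (λ i → f i j))
sum-comm zero    k f = sym (sum-zero k (λ _ → refl))
sum-comm (suc n) k f = trans (cong (sumFin k (f zero) +_) (sum-comm n k (f ∘ suc)))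
                             (sym (sum-+ k (f zero) _))

sum-const : ∀ n → sumFin n (λ _ → 1) ≡ n
sum-const zero    = refl
sum-const (suc n) = cong suc (sum-const n)

sum-mono-≤ : ∀ n {f g : Fin n → ℕ} → (∀ i → f i ≤ g i) → sumFin n f ≤ sumFin n g
sum-mono-≤ zero    f≤g = z≤n
sum-mono-≤ (suc n) f≤g = +-mono-≤ (f≤g zero) (sum-mono-≤ n (f≤g ∘ suc))

sum-mono-≤-tight : ∀ n {f g : Fin n → ℕ} → (∀ i → f i ≤ g i) →
  sumFin n g ≤ sumFin n f → f ≗ g
sum-mono-≤-tight (suc n) {f} f≤g g≤f zero with m≤n⇒m<n∨m≡n (f≤g zero)
... | inj₂ eq = eq
... | inj₁ lt = ⊥-elim (<⇒≱ (+-mono-<-≤ lt (sum-mono-≤ n (f≤g ∘ suc))) g≤f)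
sum-mono-≤-tight (suc n) {f} f≤g g≤f (suc i) = sum-mono-≤-tight n (f≤g ∘ suc)
  (+-cancelˡ-≤ (f zero) _ _ (≤-trans (+-monoˡ-≤ _ (f≤g zero)) g≤f)) i

when : Bool → ℕ → ℕ
when b c = if b then c else 0

when-false : ∀ {b} c → b ≡ false → when b c ≡ 0
when-false c refl = refl

when-0 : ∀ b → when b 0 ≡ 0
when-0 true  = refl
when-0 false = refl

when-∧ : ∀ x y c → when (x ∧ y) c ≡ when x (when y c)
when-∧ true  y c = refl
when-∧ false y c = refl

when-comm : ∀ x y c → when x (when y c) ≡ when y (when x c)
when-comm true  y     c = refl
when-comm false true  c = refl
when-comm false false c = refl

when-∧-absorb : ∀ x y c → when x (when (x ∧ y) c) ≡ when (x ∧ y) c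
when-∧-absorb true  y c = refl
when-∧-absorb false y c = refl

when-∨ : ∀ x y c → x ∧ y ≡ false → when (x ∨ y) c ≡ when x c + when y c
when-∨ true  false c _ = sym (+-identityʳ c)
when-∨ false y     c _ = refl

when-+ : ∀ b c d → when b (c + d) ≡ when b c + when b d
when-+ true  c d = refl
when-+ false c d = refl

when-*ʳ : ∀ b c → when b c ≡ c * when b 1
when-*ʳ true  c = sym (*-identityʳ c)
when-*ʳ false c = sym (*-zeroʳ c)

when-mono-≤ : ∀ b {c d} → c ≤ d → when b c ≤ when b d
when-mono-≤ true  c≤d = c≤d
when-mono-≤ false c≤d = z≤n

sum-when : ∀ n b (f : Fin n → ℕ) → sumFin n (λ i → when b (f i)) ≡ when b (sumFin n f)
sum-when n true  f = refl
sum-when n false f = sum-zero n (λ _ → refl)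

module _ {n : ℕ} where

  _∪_ _∩_ : (Fin n → Bool) → (Fin n → Bool) → Fin n → Bool
  (f ∪ g) u = f u ∨ g u
  (f ∩ g) u = f u ∧ g u

  _⊆_ : (Fin n → Bool) → (Fin n → Bool) → Set
  f ⊆ g = ∀ u → f u ≡ true → g u ≡ true

  Disjoint : (Fin n → Bool) → (Fin n → Bool) → Set
  Disjoint f g = ∀ u → f u ∧ g u ≡ false

  card : (Fin n → Bool) → ℕ
  card f = sumFin n (λ u → when (f u) 1)

  degIn : Mult n → (Fin n → Bool) → Fin n → ℕ
  degIn m g u = sumFin n (λ w → when (g w) (m u w))

  -- Counts ordered pairs, so edges m f f = 2e(⟨f⟩).
  edges : Mult n → (Fin n → Bool) → (Fin n → Bool) → ℕ
  edges m f g = sumFin n (λ u → when (f u) (degIn m g u))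

  hasDeg : Mult n → ℕ → Fin n → Bool
  hasDeg m D u = ⌊ deg m u ≟ D ⌋

card-cong : ∀ {n} {f g : Fin n → Bool} → f ≗ g → card f ≡ card g
card-cong {n} f≗g = sum-cong n (λ u → cong (λ b → when b 1) (f≗g u))

card-∪ : ∀ {n} (f g : Fin n → Bool) → Disjoint f g → card (f ∪ g) ≡ card f + card g
card-∪ {n} f g f∩g≡∅ = trans (sum-cong n (λ u → when-∨ (f u) (g u) 1 (f∩g≡∅ u))) (sum-+ n _ _)

card-partition : ∀ {n} (g f : Fin n → Bool) → card f ≡ card (g ∩ f) + card ((not ∘ g) ∩ f)
card-partition g f = trans (card-cong split) (card-∪ (g ∩ f) ((not ∘ g) ∩ f) disjoint)
  where
  split : f ≗ ((g ∩ f) ∪ ((not ∘ g) ∩ f))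
  split u with g u
  ... | true  = sym (∨-identityʳ (f u))
  ... | false = refl
  disjoint : Disjoint (g ∩ f) ((not ∘ g) ∩ f)
  disjoint u with g u
  ... | true  = ∧-zeroʳ (f u)
  ... | false = refl

card≡0⇒empty : ∀ {n} (f : Fin n → Bool) → card f ≡ 0 → ∀ u → f u ≡ false
card≡0⇒empty f c≡0 zero    with f zero
... | false = refl
card≡0⇒empty f c≡0 (suc u) with f zero
... | false = card≡0⇒empty (f ∘ suc) c≡0 u

card-lookup : ∀ {n} (V : Vec Bool n) → ∣ V ∣ ≡ card (lookup V)
card-lookup []          = refl
card-lookup (true ∷ V)  = cong suc (card-lookup V)
card-lookup (false ∷ V) = card-lookup V

card-tabulate : ∀ {n} (f : Fin n → Bool) → ∣ tabulate f ∣ ≡ card f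
card-tabulate f = trans (card-lookup (tabulate f)) (card-cong (lookup∘tabulate f))

sum-when-const : ∀ {n} (f : Fin n → Bool) c → sumFin n (λ u → when (f u) c) ≡ c * card f
sum-when-const {n} f c = trans (sum-cong n (λ u → when-*ʳ (f u) c)) (sum-*ˡ n c _)

edges-cong : ∀ {n} (m : Mult n) {f f′ g g′ : Fin n → Bool} → f ≗ f′ → g ≗ g′ →
  edges m f g ≡ edges m f′ g′
edges-cong {n} m f≗f′ g≗g′ = sum-cong n λ u →
  cong₂ when (f≗f′ u) (sum-cong n (λ w → cong (λ b → when b _) (g≗g′ w)))

edges-∪ˡ : ∀ {n} (m : Mult n) (f g h : Fin n → Bool) → Disjoint f g →
  edges m (f ∪ g) h ≡ edges m f h + edges m g h
edges-∪ˡ {n} m f g h f∩g≡∅ =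
  trans (sum-cong n (λ u → when-∨ (f u) (g u) _ (f∩g≡∅ u))) (sum-+ n _ _)

degIn-∪ : ∀ {n} (m : Mult n) (g h : Fin n → Bool) → Disjoint g h →
  ∀ u → degIn m (g ∪ h) u ≡ degIn m g u + degIn m h u
degIn-∪ {n} m g h g∩h≡∅ u =
  trans (sum-cong n (λ w → when-∨ (g w) (h w) _ (g∩h≡∅ w))) (sum-+ n _ _)

edges-∪ʳ : ∀ {n} (m : Mult n) (f g h : Fin n → Bool) → Disjoint g h →
  edges m f (g ∪ h) ≡ edges m f g + edges m f h
edges-∪ʳ {n} m f g h g∩h≡∅ = trans
  (sum-cong n (λ u → trans (cong (when (f u)) (degIn-∪ m g h g∩h≡∅ u)) (when-+ (f u) _ _)))
  (sum-+ n _ _)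

edges-comm : ∀ {n} (m : Mult n) → IsMultigraph m → ∀ f g → edges m f g ≡ edges m g f
edges-comm {n} m (symmetric , _) f g = begin
  sumFin n (λ u → when (f u) (sumFin n (λ w → when (g w) (m u w))))
    ≡⟨ sum-cong n (λ u → sym (sum-when n (f u) _)) ⟩
  sumFin n (λ u → sumFin n (λ w → when (f u) (when (g w) (m u w))))
    ≡⟨ sum-comm n n _ ⟩
  sumFin n (λ w → sumFin n (λ u → when (f u) (when (g w) (m u w))))
    ≡⟨ sum-cong n (λ w → trans (sum-cong n (λ u → trans (when-comm (f u) (g w) _)
                                  (cong (when (g w) ∘ when (f u)) (symmetric u w))))
                               (sum-when n (g w) _)) ⟩
  sumFin n (λ w → when (g w) (sumFin n (λ u → when (f u) (m w u)))) ∎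
  where open ≡-Reasoning

twoEdgesIn≡edges : ∀ {n} (m : Mult n) (V : Subset n) → twoEdgesIn m V ≡ edges m (lookup V) (lookup V)
twoEdgesIn≡edges {n} m V = sum-cong n λ u →
  trans (sum-cong n (λ w → when-∧ (lookup V u) (lookup V w) (m u w))) (sum-when n (lookup V u) _)

twoEdgesIn-tabulate : ∀ {n} (m : Mult n) (f : Fin n → Bool) → twoEdgesIn m (tabulate f) ≡ edges m f f
twoEdgesIn-tabulate m f =
  trans (twoEdgesIn≡edges m (tabulate f)) (edges-cong m (lookup∘tabulate f) (lookup∘tabulate f))

edges-loopless : ∀ {n} (m : Mult n) → (∀ v → m v v ≡ 0) → (f : Fin n → Bool) → card f ≤ 1 →
  edges m f f ≡ 0
edges-loopless {zero}  m loopless f c≤1 = refl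
edges-loopless {suc n} m loopless f c≤1 with f zero
... | false = edges-loopless (λ u w → m (suc u) (suc w)) (loopless ∘ suc) (f ∘ suc) c≤1
... | true  = cong₂ _+_ (cong₂ _+_ (loopless zero) (sum-zero n (λ w → when-false _ (empty w))))
                        (sum-zero n (λ u → when-false _ (empty u)))
  where
  empty : ∀ u → f (suc u) ≡ false
  empty = card≡0⇒empty (f ∘ suc) (n≤0⇒n≡0 (≤-pred c≤1))

module _ {n : ℕ} (g : Fin n → Bool) where

  complement-disjoint : Disjoint g (not ∘ g)
  complement-disjoint u with g u
  ... | true  = refl
  ... | false = refl

  ∪-complement : (g ∪ (not ∘ g)) ≗ (λ _ → true)
  ∪-complement u with g u
  ... | true  = refl
  ... | false = refl

deg-split : ∀ {n} (m : Mult n) (g : Fin n → Bool) u → deg m u ≡ degIn m g u + degIn m (not ∘ g) u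
deg-split {n} m g u = trans
  (sum-cong n (λ w → cong (λ b → when b (m u w)) (sym (∪-complement g w))))
  (degIn-∪ m g (not ∘ g) (complement-disjoint g) u)

edges-split : ∀ {n} (m : Mult n) (f g : Fin n → Bool) →
  edges m f (λ _ → true) ≡ edges m f g + edges m f (not ∘ g)
edges-split m f g = trans (edges-cong m (λ _ → refl) (sym ∘ ∪-complement g))
                          (edges-∪ʳ m f g (not ∘ g) (complement-disjoint g))

module _ {n : ℕ} (m : Mult n) {D : ℕ} (Δ≤D : MaxDegLe m D) (f : Fin n → Bool) where

  private
    deg≤D : ∀ u → when (f u) (deg m u) ≤ when (f u) D
    deg≤D u = when-mono-≤ (f u) (Δ≤D u)

  degree-sum≤ : edges m f (λ _ → true) ≤ D * card f
  degree-sum≤ = ≤-trans (sum-mono-≤ n deg≤D) (≤-reflexive (sum-when-const f D))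

  degree-sum-tight : edges m f (λ _ → true) ≡ D * card f → ∀ u → f u ≡ true → deg m u ≡ D
  degree-sum-tight sum≡ u fu = subst (λ b → when b (deg m u) ≡ when b D) fu $
    sum-mono-≤-tight n deg≤D (≤-reflexive (trans (sum-when-const f D) (sym sum≡))) u

parity : ∀ a → Even a ⊎ Odd a
parity a with a % 2 | m%n<n a 2
... | 0           | _               = inj₁ refl
... | 1           | _               = inj₂ refl
... | suc (suc _) | s≤s (s≤s ())

odd+even⇒odd : ∀ {a b} → Odd a → Even b → Odd (a + b)
odd+even⇒odd {a} {b} oa eb = trans (%-distribˡ-+ a b 2) (cong₂ (λ x y → (x + y) % 2) oa eb)

even+odd⇒odd : ∀ {a b} → Even a → Odd (a + b) → Odd b
even+odd⇒odd {a} {b} ea oab with parity b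
... | inj₂ ob = ob
... | inj₁ eb = ⊥-elim (0≢1+n (trans (sym (trans (%-distribˡ-+ a b 2)
                  (cong₂ (λ x y → (x + y) % 2) ea eb))) oab))

odd-suc⇒even : ∀ {a} → Odd (suc a) → Even a
odd-suc⇒even {a} oa+1 with parity a
... | inj₁ ea = ea
... | inj₂ oa = ⊥-elim (0≢1+n (trans (sym (trans (%-distribˡ-+ 1 a 2)
                  (cong (λ x → (1 + x) % 2) oa))) oa+1))

odd⇒1∨≥3 : ∀ a → Odd a → a ≡ 1 ⊎ 3 ≤ a
odd⇒1∨≥3 1                   _ = inj₁ refl
odd⇒1∨≥3 (suc (suc (suc a))) _ = inj₂ (s≤s (s≤s (s≤s z≤n)))

odd⇒≥1 : ∀ a → Odd a → 1 ≤ a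
odd⇒≥1 (suc a) _ = s≤s z≤n

*-pred : ∀ D a → 1 ≤ a → D * a ≡ D * (a ∸ 1) + D
*-pred D (suc a) _ = trans (*-suc D a) (+-comm D (D * a))

mkℚᵘ≤ℕ⇒≤ : ∀ a c D → mkℚᵘ (ℤ.+ a) c ℚᵘ.≤ ℕtoℚ D → a ≤ D * suc c
mkℚᵘ≤ℕ⇒≤ a c D (*≤* le) = subst (_≤ D * suc c) (*-identityʳ a) $
  ℤ.drop‿+≤+ (subst₂ ℤ._≤_ (sym (ℤ.pos-* a 1)) (sym (ℤ.pos-* D (suc c))) le)

≤⇒mkℚᵘ≤ℕ : ∀ a c D → a ≤ D * suc c → mkℚᵘ (ℤ.+ a) c ℚᵘ.≤ ℕtoℚ D
≤⇒mkℚᵘ≤ℕ a c D le = *≤* (subst₂ ℤ._≤_ (ℤ.pos-* a 1) (ℤ.pos-* D (suc c))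
  (ℤ.+≤+ (subst (_≤ D * suc c) (sym (*-identityʳ a)) le)))

mkℚᵘ≃ℕ⇒≡ : ∀ a c D → mkℚᵘ (ℤ.+ a) c ≃ ℕtoℚ D → a ≡ D * suc c
mkℚᵘ≃ℕ⇒≡ a c D (*≡* eq) = trans (sym (*-identityʳ a)) $
  ℤ.+-injective (trans (ℤ.pos-* a 1) (trans eq (sym (ℤ.pos-* D (suc c)))))

suc[∸2]≡∸1 : ∀ a → 2 ≤ a → suc (a ∸ 2) ≡ a ∸ 1
suc[∸2]≡∸1 (suc (suc a)) _           = refl
suc[∸2]≡∸1 (suc zero)    (s≤s ())

module _ {n : ℕ} (m : Mult n) (V : Subset n) (D : ℕ) (2≤∣V∣ : 2 ≤ ∣ V ∣) where

  private
    ∣V∣-1 : suc (∣ V ∣ ∸ 2) ≡ ∣ V ∣ ∸ 1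
    ∣V∣-1 = suc[∸2]≡∸1 ∣ V ∣ 2≤∣V∣

  tSub≤⇒ : tSub m V ℚᵘ.≤ ℕtoℚ D → twoEdgesIn m V ≤ D * (∣ V ∣ ∸ 1)
  tSub≤⇒ le = subst (λ k → twoEdgesIn m V ≤ D * k) ∣V∣-1 (mkℚᵘ≤ℕ⇒≤ _ _ D le)

  ≤⇒tSub≤ : twoEdgesIn m V ≤ D * (∣ V ∣ ∸ 1) → tSub m V ℚᵘ.≤ ℕtoℚ D
  ≤⇒tSub≤ le = ≤⇒mkℚᵘ≤ℕ _ _ D (subst (λ k → twoEdgesIn m V ≤ D * k) (sym ∣V∣-1) le)

  tSub≃⇒ : tSub m V ≃ ℕtoℚ D → twoEdgesIn m V ≡ D * (∣ V ∣ ∸ 1)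
  tSub≃⇒ eq = trans (mkℚᵘ≃ℕ⇒≡ _ _ D eq) (cong (D *_) ∣V∣-1)

odd-edges≤ : ∀ {n} (m : Mult n) → IsMultigraph m → ∀ {D} → GammaLe m D →
  (f : Fin n → Bool) → Odd (card f) → edges m f f ≤ D * (card f ∸ 1)
odd-edges≤ {n} m (_ , loopless) {D} Γ≤D f odd with odd⇒1∨≥3 (card f) odd
... | inj₁ ∣f∣≡1 = ≤-trans (≤-reflexive (edges-loopless m loopless f (≤-reflexive ∣f∣≡1))) z≤n
... | inj₂ 3≤∣f∣ = subst₂ (λ e k → e ≤ D * (k ∸ 1)) (twoEdgesIn-tabulate m f) (card-tabulate f) $
  tSub≤⇒ m V D (≤-trans (s≤s (s≤s z≤n)) 3≤∣V∣) (Γ≤D V (subst Odd (sym ∣V∣≡) odd) 3≤∣V∣)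
  where
  V : Subset n
  V = tabulate f
  ∣V∣≡ : ∣ V ∣ ≡ card f
  ∣V∣≡ = card-tabulate f
  3≤∣V∣ : 3 ≤ ∣ V ∣
  3≤∣V∣ = subst (3 ≤_) (sym ∣V∣≡) 3≤∣f∣

sumFin-filterᵇ : ∀ {n} (p : Fin n → Bool) (F : Fin n → ℕ) xs →
  sumFin (length (filterᵇ p xs)) (F ∘ List.lookup (filterᵇ p xs)) ≡ sum (List.map (λ u → when (p u) (F u)) xs)
sumFin-filterᵇ p F []       = refl
sumFin-filterᵇ p F (x ∷ xs) with p x
... | true  = cong (F x +_) (sumFin-filterᵇ p F xs)
... | false = sumFin-filterᵇ p F xs

sum-map-tabulate : ∀ n {A : Set} (G : A → ℕ) (f : Fin n → A) →
  sum (List.map G (List.tabulate f)) ≡ sumFin n (G ∘ f)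
sum-map-tabulate zero    G f = refl
sum-map-tabulate (suc n) G f = cong (G (f zero) +_) (sum-map-tabulate n G (f ∘ suc))

-- 1 + the index of u in xs, or 0 if u does not occur in xs.
position : ∀ {n} (xs : List (Fin n)) → Fin n → Fin (suc (length xs))
position []       u = zero
position (x ∷ xs) u with x Finₚ.≟ u | position xs u
... | yes _ | _     = suc zero
... | no _  | zero  = zero
... | no _  | suc j = suc (suc j)

position-lookup : ∀ {n} (xs : List (Fin n)) → Unique xs → ∀ j → position xs (List.lookup xs j) ≡ suc j
position-lookup (x ∷ xs) _ zero with x Finₚ.≟ x
... | yes _  = refl
... | no x≢x = ⊥-elim (x≢x refl)
position-lookup (x ∷ xs) (x∉xs ∷ unique) (suc j)
  with x Finₚ.≟ List.lookup xs j | position xs (List.lookup xs j) | position-lookup xs unique j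
... | yes x≡ | _ | _    = ⊥-elim (All.lookup x∉xs (∈-lookup j) x≡)
... | no _   | _ | refl = refl

module Shrink {n : ℕ} (m : Mult n) (P : Subset n) where

  inP outP : Fin n → Bool
  inP      = lookup P
  outP u   = not (inP u)

  k : ℕ
  k = length (outside P)

  vertex : Fin k → Fin n
  vertex = List.lookup (outside P)

  vertex-outside : ∀ i → inP (vertex i) ≡ false
  vertex-outside i = T-not⇒false (All.lookup (all-filter (T? ∘ outP) (allFin n)) (∈-lookup i))
    where
    T-not⇒false : ∀ {b} → T (not b) → b ≡ false
    T-not⇒false {false} _ = refl

  sum-vertex : (F : Fin n → ℕ) → sumFin k (F ∘ vertex) ≡ sumFin n (λ u → when (outP u) (F u))
  sum-vertex F = trans (sumFin-filterᵇ outP F (allFin n)) (sum-map-tabulate n _ (λ u → u))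

  shrinkN≡ : shrinkN P ≡ suc (card outP)
  shrinkN≡ = cong suc (trans (sym (sum-const k)) (sum-vertex (λ _ → 1)))

  deg-new : deg (shrink m P) zero ≡ edges m outP inP
  deg-new = sum-vertex (degIn m inP)

  deg-old : ∀ i → deg (shrink m P) (suc i) ≡ deg m (vertex i)
  deg-old i = trans (cong (degIn m inP (vertex i) +_) (sum-vertex (m (vertex i))))
                    (sym (deg-split m inP (vertex i)))

  numDeg-shrink : ∀ D → numDeg (shrink m P) D ≡ when ⌊ edges m outP inP ≟ D ⌋ 1 + card (outP ∩ hasDeg m D)
  numDeg-shrink D = cong₂ _+_ (cong (λ e → when ⌊ e ≟ D ⌋ 1) deg-new) $ begin
    sumFin k (λ i → when (hasDeg (shrink m P) D (suc i)) 1)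
      ≡⟨ sum-cong k (λ i → cong (λ e → when ⌊ e ≟ D ⌋ 1) (deg-old i)) ⟩
    sumFin k (λ i → when (hasDeg m D (vertex i)) 1)
      ≡⟨ sum-vertex (λ u → when (hasDeg m D u) 1) ⟩
    sumFin n (λ u → when (outP u) (when (hasDeg m D u) 1))
      ≡⟨ sum-cong n (λ u → sym (when-∧ (outP u) _ 1)) ⟩
    card (outP ∩ hasDeg m D) ∎
    where open ≡-Reasoning

  numDeg-split : ∀ D → numDeg m D ≡ card (inP ∩ hasDeg m D) + card (outP ∩ hasDeg m D)
  numDeg-split D = card-partition inP (hasDeg m D)

  module _ (T : Subset (shrinkN P)) where

    preimage : Fin n → Bool
    preimage u = outP u ∧ lookup T (position (outside P) u)

    preimage⊆outP : preimage ⊆ outP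
    preimage⊆outP u with outP u
    ... | true = λ _ → refl

    preimage-vertex : ∀ i → preimage (vertex i) ≡ lookup T (suc i)
    preimage-vertex i rewrite vertex-outside i =
      cong (lookup T) (position-lookup (outside P) (filter⁺ (T? ∘ outP) (allFin⁺ n)) i)

    sum-preimage : (F : Fin n → ℕ) →
      sumFin k (λ i → when (lookup T (suc i)) (F (vertex i))) ≡ sumFin n (λ u → when (preimage u) (F u))
    sum-preimage F = begin
      sumFin k (λ i → when (lookup T (suc i)) (F (vertex i)))
        ≡⟨ sum-cong k (λ i → cong (λ b → when b (F (vertex i))) (sym (preimage-vertex i))) ⟩
      sumFin k (λ i → when (preimage (vertex i)) (F (vertex i)))
        ≡⟨ sum-vertex (λ u → when (preimage u) (F u)) ⟩
      sumFin n (λ u → when (outP u) (when (preimage u) (F u)))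
        ≡⟨ sum-cong n (λ u → when-∧-absorb (outP u) _ (F u)) ⟩
      sumFin n (λ u → when (preimage u) (F u)) ∎
      where open ≡-Reasoning

    card-shrunk : ∣ T ∣ ≡ when (lookup T zero) 1 + card preimage
    card-shrunk = trans (card-lookup T) (cong (when (lookup T zero) 1 +_) (sum-preimage (λ _ → 1)))

    degIn-shrunk-new : degIn (shrink m P) (lookup T) zero ≡ edges m preimage inP
    degIn-shrunk-new = cong₂ _+_ (when-0 (lookup T zero)) (sum-preimage (degIn m inP))

    degIn-shrunk-old : ∀ i → degIn (shrink m P) (lookup T) (suc i) ≡
      when (lookup T zero) (degIn m inP (vertex i)) + degIn m preimage (vertex i)
    degIn-shrunk-old i = cong (when (lookup T zero) (degIn m inP (vertex i)) +_) (sum-preimage (m (vertex i)))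

    twoEdgesIn-shrunk : twoEdgesIn (shrink m P) T ≡
      when (lookup T zero) (edges m preimage inP)
        + (when (lookup T zero) (edges m preimage inP) + edges m preimage preimage)
    twoEdgesIn-shrunk = begin
      twoEdgesIn H T
        ≡⟨ twoEdgesIn≡edges H T ⟩
      when τ₀ (degIn H τ zero) + sumFin k (λ i → when (τ (suc i)) (degIn H τ (suc i)))
        ≡⟨ cong₂ (λ x y → when τ₀ x + y) degIn-shrunk-new (sum-cong k λ i →
             trans (cong (when (τ (suc i))) (degIn-shrunk-old i)) (when-+ (τ (suc i)) _ _)) ⟩
      when τ₀ (edges m A inP) + sumFin k (λ i → when (τ (suc i)) (when τ₀ (degIn m inP (vertex i)))
                                                + when (τ (suc i)) (degIn m A (vertex i)))
        ≡⟨ cong (when τ₀ (edges m A inP) +_) (trans (sum-+ k _ _)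
             (cong₂ _+_ (sum-preimage (λ u → when τ₀ (degIn m inP u))) (sum-preimage (degIn m A)))) ⟩
      when τ₀ (edges m A inP) + (sumFin n (λ u → when (A u) (when τ₀ (degIn m inP u))) + edges m A A)
        ≡⟨ cong (λ x → when τ₀ (edges m A inP) + (x + edges m A A))
             (trans (sum-cong n (λ u → when-comm (A u) τ₀ _)) (sum-when n τ₀ _)) ⟩
      when τ₀ (edges m A inP) + (when τ₀ (edges m A inP) + edges m A A) ∎
      where
      open ≡-Reasoning
      H : Mult (shrinkN P)
      H = shrink m P
      τ : Fin (shrinkN P) → Bool
      τ = lookup T
      τ₀ : Bool
      τ₀ = τ zero
      A : Fin n → Bool
      A = preimage

  shrink-MaxDegLe : ∀ {D} → MaxDegLe m D → edges m outP inP ≤ D → MaxDegLe (shrink m P) D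
  shrink-MaxDegLe Δ≤D e≤D zero    = subst (_≤ _) (sym deg-new) e≤D
  shrink-MaxDegLe Δ≤D e≤D (suc i) = subst (_≤ _) (sym (deg-old i)) (Δ≤D (vertex i))

  -- An odd set of H_P avoiding s is an odd set of H; one containing s is {s} ∪ A with A
  -- outside P and |A| even, and 2e(⟨{s} ∪ A⟩) = 2e(A, P) + 2e(⟨A⟩).
  shrink-GammaLe : IsMultigraph m → ∀ {D} → GammaLe m D →
    (∀ A → A ⊆ outP → Even (card A) → edges m A inP + (edges m A inP + edges m A A) ≤ D * card A) →
    GammaLe (shrink m P) D
  shrink-GammaLe ism {D} Γ≤D bound T oddT 3≤∣T∣ = ≤⇒tSub≤ (shrink m P) T D (≤-trans (s≤s (s≤s z≤n)) 3≤∣T∣)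
    (subst₂ (λ e c → e ≤ D * (c ∸ 1)) (sym (twoEdgesIn-shrunk T)) (sym (card-shrunk T)) (by-s∈T (lookup T zero) refl))
    where
    A : Fin n → Bool
    A = preimage T
    oddA : ∀ {b} → lookup T zero ≡ b → Odd (when b 1 + card A)
    oddA refl = subst Odd (card-shrunk T) oddT
    by-s∈T : ∀ b → lookup T zero ≡ b →
      when b (edges m A inP) + (when b (edges m A inP) + edges m A A) ≤ D * (when b 1 + card A ∸ 1)
    by-s∈T false s∉T = odd-edges≤ m ism Γ≤D A (oddA s∉T)
    by-s∈T true  s∈T = bound A (preimage⊆outP T) (odd-suc⇒even {card A} (oddA s∈T))

  shrink-numDeg≤ : ∀ {D} → (edges m outP inP ≡ D → 1 ≤ card (inP ∩ hasDeg m D)) →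
    numDeg (shrink m P) D ≤ numDeg m D
  shrink-numDeg≤ {D} s-has-deg-D = subst₂ _≤_ (sym (numDeg-shrink D)) (sym (numDeg-split D))
    (+-monoˡ-≤ _ (indicator≤ (edges m outP inP ≟ D)))
    where
    indicator≤ : (dec : Dec (edges m outP inP ≡ D)) → when ⌊ dec ⌋ 1 ≤ card (inP ∩ hasDeg m D)
    indicator≤ (yes e≡D) = s-has-deg-D e≡D
    indicator≤ (no _)    = z≤n

  shrink-numDeg-grows : ∀ {D} → numDeg m D < numDeg (shrink m P) D →
    edges m outP inP ≡ D × numDeg m D ≡ card (outP ∩ hasDeg m D)
  shrink-numDeg-grows {D} grows with edges m outP inP ≟ D | subst₂ _<_ (numDeg-split D) (numDeg-shrink D) grows
  ... | yes e≡D | grows′ = e≡D , trans (numDeg-split D) (≤-antisym (≤-pred grows′) (m≤n+m _ _))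
  ... | no _    | grows′ = ⊥-elim (<⇒≱ grows′ (m≤n+m _ _))

module TightSet {n : ℕ} (m : Mult n) (ism : IsMultigraph m) {D : ℕ}
  (Δ≤D : MaxDegLe m D) (Γ≤D : GammaLe m D)
  (S : Subset n) (oddS : Odd (card (lookup S))) (tight : edges m (lookup S) (lookup S) ≡ D * (card (lookup S) ∸ 1))
  where

  X : Fin n → Bool
  X = lookup S

  1≤∣X∣ : 1 ≤ card X
  1≤∣X∣ = odd⇒≥1 (card X) oddS

  D∣X∣≡ : D * card X ≡ edges m X X + D
  D∣X∣≡ = trans (*-pred D (card X) 1≤∣X∣) (cong (_+ D) (sym tight))

  boundary≤ : edges m X (not ∘ X) ≤ D
  boundary≤ = +-cancelˡ-≤ (edges m X X) _ _ (subst₂ _≤_ (edges-split m X X) D∣X∣≡ (degree-sum≤ m Δ≤D X))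

  boundary≡⇒regular : edges m X (not ∘ X) ≡ D → ∀ u → X u ≡ true → deg m u ≡ D
  boundary≡⇒regular e≡D = degree-sum-tight m Δ≤D X
    (trans (edges-split m X X) (trans (cong (edges m X X +_) e≡D) (sym D∣X∣≡)))

  boundary≡⇒X∩hasDeg≗X : edges m X (not ∘ X) ≡ D → (X ∩ hasDeg m D) ≗ X
  boundary≡⇒X∩hasDeg≗X e≡D u with X u in Xu
  ... | false = refl
  ... | true  = trans (isYes≗does (deg m u ≟ D)) (dec-true (deg m u ≟ D) (boundary≡⇒regular e≡D u Xu))

  outside-bound : ∀ A → A ⊆ (not ∘ X) → Even (card A) →
    edges m A X + (edges m A X + edges m A A) ≤ D * card A
  outside-bound A A⊆∁X evenA = +-cancelˡ-≤ (edges m X X) _ _ $ begin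
    edges m X X + (edges m A X + (edges m A X + edges m A A))
      ≡⟨ sym (+-assoc (edges m X X) _ _) ⟩
    (edges m X X + edges m A X) + (edges m A X + edges m A A)
      ≡⟨ cong (λ e → (edges m X X + e) + (edges m A X + edges m A A)) (edges-comm m ism A X) ⟩
    (edges m X X + edges m X A) + (edges m A X + edges m A A)
      ≡⟨ sym (cong₂ _+_ (edges-∪ʳ m X X A disjoint) (edges-∪ʳ m A X A disjoint)) ⟩
    edges m X (X ∪ A) + edges m A (X ∪ A)
      ≡⟨ sym (edges-∪ˡ m X A (X ∪ A) disjoint) ⟩
    edges m (X ∪ A) (X ∪ A)
      ≤⟨ odd-edges≤ m ism Γ≤D (X ∪ A) (subst Odd (sym ∣X∪A∣) (odd+even⇒odd {card X} oddS evenA)) ⟩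
    D * (card (X ∪ A) ∸ 1)
      ≡⟨ cong (λ c → D * (c ∸ 1)) ∣X∪A∣ ⟩
    D * (card X + card A ∸ 1)
      ≡⟨ cong (D *_) (+-∸-comm (card A) 1≤∣X∣) ⟩
    D * (card X ∸ 1 + card A)
      ≡⟨ *-distribˡ-+ D (card X ∸ 1) (card A) ⟩
    D * (card X ∸ 1) + D * card A
      ≡⟨ cong (_+ D * card A) (sym tight) ⟩
    edges m X X + D * card A ∎
    where
    open ≤-Reasoning
    disjoint : Disjoint X A
    disjoint u with A u in Au
    ... | false = ∧-zeroʳ (X u)
    ... | true  with X u | A⊆∁X u Au
    ...   | false | _ = refl
    ∣X∪A∣ : card (X ∪ A) ≡ card X + card A
    ∣X∪A∣ = card-∪ X A disjoint

  inside-bound : ∀ A → A ⊆ X → Even (card A) →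
    edges m A (not ∘ X) + (edges m A (not ∘ X) + edges m A A) ≤ D * card A
  inside-bound A A⊆X evenA =
    exchange (edges m A A) (edges m A B) (edges m A (not ∘ X)) (edges m B B) edges-X≡ B-bound A-bound
    where
    B : Fin n → Bool
    B = (not ∘ A) ∩ X

    X≗A∪B : X ≗ (A ∪ B)
    X≗A∪B u with A u in Au
    ... | true  = A⊆X u Au
    ... | false = refl

    disjoint : Disjoint A B
    disjoint u with A u
    ... | true  = refl
    ... | false = refl

    ∣X∣≡ : card X ≡ card A + card B
    ∣X∣≡ = trans (card-cong X≗A∪B) (card-∪ A B disjoint)

    oddB : Odd (card B)
    oddB = even+odd⇒odd {card A} evenA (subst Odd ∣X∣≡ oddS)

    B-bound : edges m B B ≤ D * (card B ∸ 1)
    B-bound = odd-edges≤ m ism Γ≤D B oddB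

    A-bound : (edges m A A + edges m A B) + edges m A (not ∘ X) ≤ D * card A
    A-bound = subst (_≤ D * card A)
      (trans (edges-split m A X) (cong (_+ edges m A (not ∘ X))
        (trans (edges-cong m (λ _ → refl) X≗A∪B) (edges-∪ʳ m A A B disjoint))))
      (degree-sum≤ m Δ≤D A)

    edges-X≡ : (edges m A A + edges m A B) + (edges m A B + edges m B B) ≡ D * card A + D * (card B ∸ 1)
    edges-X≡ = begin
      (edges m A A + edges m A B) + (edges m A B + edges m B B)
        ≡⟨ cong (λ e → (edges m A A + edges m A B) + (e + edges m B B)) (edges-comm m ism A B) ⟩
      (edges m A A + edges m A B) + (edges m B A + edges m B B)
        ≡⟨ sym (cong₂ _+_ (edges-∪ʳ m A A B disjoint) (edges-∪ʳ m B A B disjoint)) ⟩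
      edges m A (A ∪ B) + edges m B (A ∪ B)
        ≡⟨ sym (edges-∪ˡ m A B (A ∪ B) disjoint) ⟩
      edges m (A ∪ B) (A ∪ B)
        ≡⟨ sym (edges-cong m X≗A∪B X≗A∪B) ⟩
      edges m X X
        ≡⟨ tight ⟩
      D * (card X ∸ 1)
        ≡⟨ cong (λ c → D * (c ∸ 1)) ∣X∣≡ ⟩
      D * (card A + card B ∸ 1)
        ≡⟨ cong (D *_) (+-∸-assoc (card A) (odd⇒≥1 (card B) oddB)) ⟩
      D * (card A + (card B ∸ 1))
        ≡⟨ *-distribˡ-+ D (card A) (card B ∸ 1) ⟩
      D * card A + D * (card B ∸ 1) ∎
      where open ≡-Reasoning

    -- With x, y, z, w = 2e(⟨A⟩), e(A, B), e(A, Xᶜ), 2e(⟨B⟩), the count inside X forces z ≤ y.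
    exchange : ∀ x y z w {Q R} → (x + y) + (y + w) ≡ Q + R → w ≤ R → (x + y) + z ≤ Q → z + (z + x) ≤ Q
    exchange x y z w {Q} {R} x+2y+w≡ w≤R x+y+z≤Q = begin
      z + (z + x)  ≤⟨ +-monoˡ-≤ (z + x) z≤y ⟩
      y + (z + x)  ≡⟨ x∙yz≈zx∙y y z x ⟩
      (x + y) + z  ≤⟨ x+y+z≤Q ⟩
      Q            ∎
      where
      open ≤-Reasoning
      Q≤x+2y : Q ≤ (x + y) + y
      Q≤x+2y = +-cancelʳ-≤ R _ _ $ begin
        Q + R                 ≡⟨ sym x+2y+w≡ ⟩
        (x + y) + (y + w)     ≡⟨ sym (+-assoc (x + y) y w) ⟩
        ((x + y) + y) + w     ≤⟨ +-monoʳ-≤ ((x + y) + y) w≤R ⟩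
        ((x + y) + y) + R     ∎
      z≤y : z ≤ y
      z≤y = +-cancelˡ-≤ (x + y) _ _ (≤-trans x+y+z≤Q Q≤x+2y)

  shrinkS-MaxDegLe : MaxDegLe (shrink m S) D
  shrinkS-MaxDegLe = Shrink.shrink-MaxDegLe m S Δ≤D (subst (_≤ D) (edges-comm m ism X (not ∘ X)) boundary≤)

  shrinkS-GammaLe : GammaLe (shrink m S) D
  shrinkS-GammaLe = Shrink.shrink-GammaLe m S ism Γ≤D outside-bound

  shrinkS-numDeg≤ : numDeg (shrink m S) D ≤ numDeg m D
  shrinkS-numDeg≤ = Shrink.shrink-numDeg≤ m S λ e≡D →
    subst (1 ≤_) (sym (card-cong (boundary≡⇒X∩hasDeg≗X (trans (edges-comm m ism X (not ∘ X)) e≡D)))) 1≤∣X∣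

  private
    module ShrinkComplement = Shrink m (∁ S)
    open ShrinkComplement using (inP; outP)

    inP≗ : inP ≗ not ∘ X
    inP≗ u = lookup-map u not S

    outP≗ : outP ≗ X
    outP≗ u = trans (cong not (inP≗ u)) (not-involutive (X u))

    boundary≡ : edges m outP inP ≡ edges m X (not ∘ X)
    boundary≡ = edges-cong m outP≗ inP≗

  shrink∁S-MaxDegLe : MaxDegLe (shrink m (∁ S)) D
  shrink∁S-MaxDegLe = ShrinkComplement.shrink-MaxDegLe Δ≤D (subst (_≤ D) (sym boundary≡) boundary≤)

  shrink∁S-GammaLe : GammaLe (shrink m (∁ S)) D
  shrink∁S-GammaLe = ShrinkComplement.shrink-GammaLe ism Γ≤D λ A A⊆outP evenA →
    subst (λ e → e + (e + edges m A A) ≤ D * card A) (edges-cong m (λ _ → refl) (sym ∘ inP≗))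
      (inside-bound A (λ u Au → trans (sym (outP≗ u)) (A⊆outP u Au)) evenA)

  shrink∁S-numDeg-grows : numDeg m D < numDeg (shrink m (∁ S)) D →
    shrinkN (∁ S) ≡ suc (numDeg m D) × ((v : Fin (shrinkN (∁ S))) → deg (shrink m (∁ S)) v ≡ D)
  shrink∁S-numDeg-grows grows = size , regular
    where
    open ShrinkComplement using (shrink-numDeg-grows; shrinkN≡; deg-new; deg-old; vertex; vertex-outside)
    e≡D : edges m X (not ∘ X) ≡ D
    e≡D = trans (sym boundary≡) (proj₁ (shrink-numDeg-grows grows))
    size : shrinkN (∁ S) ≡ suc (numDeg m D)
    size = trans shrinkN≡ (cong suc (begin
      card outP                  ≡⟨ card-cong outP≗ ⟩
      card X                     ≡⟨ card-cong (sym ∘ boundary≡⇒X∩hasDeg≗X e≡D) ⟩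
      card (X ∩ hasDeg m D)      ≡⟨ card-cong (λ u → cong (_∧ hasDeg m D u) (sym (outP≗ u))) ⟩
      card (outP ∩ hasDeg m D)   ≡⟨ sym (proj₂ (shrink-numDeg-grows grows)) ⟩
      numDeg m D                 ∎))
      where open ≡-Reasoning
    regular : (v : Fin (shrinkN (∁ S))) → deg (shrink m (∁ S)) v ≡ D
    regular zero    = trans deg-new (trans boundary≡ e≡D)
    regular (suc i) = trans (deg-old i) (boundary≡⇒regular e≡D (vertex i)
      (trans (sym (outP≗ (vertex i))) (cong not (vertex-outside i))))

mainTheorem7 : (d n : ℕ) (m : Mult n) → IsMultigraph m → Even n →
    PhiLe m (suc d) →
    (S : Subset n) → Odd ∣ S ∣ → 3 ≤ ∣ S ∣ → tSub m S ≃ ℕtoℚ (suc d) →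
      (MaxDegLe (shrink m S) (suc d)
       × (3 ≤ shrinkN S → GammaLe (shrink m S) (suc d))
       × numDeg (shrink m S) (suc d) ≤ numDeg m (suc d))
      × (MaxDegLe (shrink m (∁ S)) (suc d)
       × (3 ≤ shrinkN (∁ S) → GammaLe (shrink m (∁ S)) (suc d))
       × (numDeg m (suc d) < numDeg (shrink m (∁ S)) (suc d) →
           (shrinkN (∁ S) ≡ suc (numDeg m (suc d))
            × ((v : Fin (shrinkN (∁ S))) → deg (shrink m (∁ S)) v ≡ suc d))))
mainTheorem7 d n m ism _ (Δ≤D , Γ≤D) S oddS 3≤∣S∣ t≡D =
    (shrinkS-MaxDegLe , const shrinkS-GammaLe , shrinkS-numDeg≤)
  , (shrink∁S-MaxDegLe , const shrink∁S-GammaLe , shrink∁S-numDeg-grows)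
  where
  tight : edges m (lookup S) (lookup S) ≡ suc d * (card (lookup S) ∸ 1)
  tight = subst₂ (λ e c → e ≡ suc d * (c ∸ 1)) (twoEdgesIn≡edges m S) (card-lookup S)
    (tSub≃⇒ m S (suc d) (≤-trans (s≤s (s≤s z≤n)) 3≤∣S∣) t≡D)

  open TightSet m ism Δ≤D (Γ≤D (≤-trans 3≤∣S∣ (∣p∣≤n S))) S (subst Odd (card-lookup S) oddS) tight
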